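{- For every positive integer $k$, $z(T_k)=\lceil (k+1)/2\rceil$.
   Context: The trees $T_k$ ("tree $k$-atoms") are defined recursively: $T_1$ is the single vertex $K_1$, $T_2$ is $K_2$, and for $k\ge 2$, $T_{k+1}$ is obtained from $T_k$ by attaching one new leaf to each vertex of $T_k$ (so $|V(T_{k+1})|=2|V(T_k)|$). A $z$-coloring of a graph $G$ is a proper vertex coloring with (nonempty) color classes $C_1,\ldots,C_k$ such that: (i) for any $1\le i<j\le k$, every vertex of color $j$ is adjacent to a vertex of color $i$; (ii) there is a set $\{u_1,\ldots,u_k\}$ of vertices with $u_j\in C_j$ for each $j$, such that $u_k$ is adjacent to $u_j$ for every $j\ne k$; and (iii) for all $i\ne j$, the vertex $u_j$ has a neighbor in $C_i$. $z(G)$ denotes the maximum number of colors used in a $z$-coloring of $G$. -}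

module Defs where

open import Level using (0ℓ)
open import Data.Nat using (ℕ; zero; suc; _+_; _∸_; _<_; _≤_; ⌊_/2⌋)
open import Data.Fin using (Fin; toℕ)
open import Data.Unit using (⊤)
open import Data.Empty using (⊥)
open import Data.Sum using (_⊎_; inj₁; inj₂)
open import Data.Product using (Σ; _×_; ∃-syntax)
open import Relation.Binary.PropositionalEquality using (_≡_; _≢_)

record Graph : Set₁ where
  field
    V   : Set
    Adj : V → V → Set
open Graph public

-- Vertices of the tree T_(m+1).  T_1 = K_1 has one vertex; T_(m+2) is
-- T_(m+1) (inj₁ side) together with one new leaf (inj₂ v) attached to
-- each old vertex v.  (Attaching a leaf to the single vertex of T_1
-- gives K_2 = T_2, so this uniform recursion matches the definition.)
TV : ℕ → Set
TV zero    = ⊤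
TV (suc m) = TV m ⊎ TV m

TAdj : (m : ℕ) → TV m → TV m → Set
TAdj zero    _        _        = ⊥
TAdj (suc m) (inj₁ a) (inj₁ b) = TAdj m a b
TAdj (suc m) (inj₁ a) (inj₂ b) = a ≡ b
TAdj (suc m) (inj₂ a) (inj₁ b) = a ≡ b
TAdj (suc m) (inj₂ a) (inj₂ b) = ⊥

T : (k : ℕ) → Graph
T zero    = record { V = ⊤ ; Adj = λ _ _ → ⊥ }   -- unused junk value
T (suc m) = record { V = TV m ; Adj = TAdj m }

-- A z-coloring of G with k colors.  Colors 1..k of the paper are
-- Fin k = {0,…,k-1} here (same order); the color class C_j is c ⁻¹ {j}.
record ZColoring (G : Graph) (k : ℕ) : Set where
  field
    c      : V G → Fin k
    proper : ∀ v w → Adj G v w → c v ≢ c w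
    cond-i : ∀ v (i : Fin k) → toℕ i < toℕ (c v) →
             ∃[ w ] (Adj G v w × c w ≡ i)
    -- (ii) representatives u_j ∈ C_j (this also makes all classes nonempty)
    u      : Fin k → V G
    u-col  : ∀ j → c (u j) ≡ j
    cond-ii : ∀ (l : Fin k) → suc (toℕ l) ≡ k →
              ∀ j → j ≢ l → Adj G (u l) (u j)
    cond-iii : ∀ (i j : Fin k) → i ≢ j → ∃[ w ] (Adj G (u j) w × c w ≡ i)

zNumberIs : Graph → ℕ → Set
zNumberIs G n = ZColoring G n × (∀ k → ZColoring G k → k ≤ n)

⌈_/2⌉ : ℕ → ℕ
⌈ x /2⌉ = ⌊ suc x /2⌋

-- Let u be the representative of the last colour of a z-colouring with
-- p + 1 colours.  By (ii) u has the p other representatives as neighbours, and by (iii)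
-- every representative has degree at least p.  List the neighbours of a vertex of
-- T_(m+1) from the youngest to the oldest: the child in position e was attached when
-- only e further layers were still to come, so it has degree at most e + 1; only the
-- parent, in the last position, can have larger degree.  Hence the p representative
-- neighbours of u occupy distinct positions ≥ p − 1 among deg u ≤ m, and 2p − 1 ≤ m.
--
-- For m ≥ 2k + 1 colour the root of T_(m+1) with k + 1 and, for x ≤ k,
-- its child with 2k − x children with x; these are the representatives, and each has
-- children of every colour ≤ k other than its own.  Below them colour greedily: a vertex
-- with r children gets colour r if r is smaller than its parent's colour (or, below a
-- representative, if r ≤ k differs from the parent's colour), and otherwise 0, or 1 if
-- the parent has colour 0.  A vertex of colour r then sees all smaller colours among
-- its children.
module Submission where

open import Defs
open import Data.Nat
  using (ℕ; zero; suc; _+_; _∸_; _⊓_; _<_; _≤_; z≤n; s≤s; s≤s⁻¹; ⌊_/2⌋; _<?_; _≟_)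
open import Data.Nat.Properties
open import Data.Fin using (Fin; toℕ; fromℕ; fromℕ<; inject₁; punchIn)
  renaming (zero to fzero; suc to fsuc)
open import Data.Fin.Properties
  using (toℕ-injective; toℕ<n; toℕ-fromℕ; toℕ-fromℕ<; fromℕ≢inject₁; inject₁-injective;
         punchIn-injective; punchInᵢ≢i; injective⇒≤)
  renaming (suc-injective to fsuc-injective)
open import Data.Sum using (_⊎_; inj₁; inj₂)
open import Data.Product using (_×_; _,_; proj₁; proj₂; ∃-syntax)
open import Data.Empty using (⊥-elim)
open import Function using (_∘_)
open import Function.Definitions using (Injective)
open import Relation.Binary.PropositionalEquality
  using (_≡_; _≢_; refl; sym; trans; cong; subst; module ≡-Reasoning)
open import Relation.Nullary using (yes; no; contradiction)

TAdj-sym : ∀ m {v w} → TAdj m v w → TAdj m w v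
TAdj-sym (suc m) {inj₁ a} {inj₁ b} p = TAdj-sym m p
TAdj-sym (suc m) {inj₁ a} {inj₂ b} p = sym p
TAdj-sym (suc m) {inj₂ a} {inj₁ b} p = sym p

root : (m : ℕ) → TV m
root zero    = _
root (suc m) = inj₁ (root m)

childCount : (m : ℕ) → TV m → ℕ
childCount zero    _        = 0
childCount (suc m) (inj₁ a) = suc (childCount m a)
childCount (suc m) (inj₂ a) = 0

childCount-root : ∀ m → childCount m (root m) ≡ m
childCount-root zero    = refl
childCount-root (suc m) = cong suc (childCount-root m)

degree : (m : ℕ) → TV m → ℕ
degree zero    _        = 0
degree (suc m) (inj₁ a) = suc (degree m a)
degree (suc m) (inj₂ a) = 1

degree≤ : ∀ m v → degree m v ≤ m
degree≤ zero    _        = z≤n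
degree≤ (suc m) (inj₁ a) = s≤s (degree≤ m a)
degree≤ (suc m) (inj₂ a) = s≤s z≤n

-- Neighbours are numbered from the youngest (index 0) to the oldest.
neighbourIndex : ∀ m {v w} → TAdj m v w → Fin (degree m v)
neighbourIndex (suc m) {inj₁ a} {inj₁ b} p = fsuc (neighbourIndex m p)
neighbourIndex (suc m) {inj₁ a} {inj₂ b} p = fzero
neighbourIndex (suc m) {inj₂ a} {inj₁ b} p = fzero

neighbourIndex-injective : ∀ m {v w w′} (p : TAdj m v w) (q : TAdj m v w′) →
                           neighbourIndex m p ≡ neighbourIndex m q → w ≡ w′
neighbourIndex-injective (suc m) {inj₁ a} {inj₁ b} {inj₁ b′} p q e =
  cong inj₁ (neighbourIndex-injective m p q (fsuc-injective e))
neighbourIndex-injective (suc m) {inj₁ a} {inj₂ b} {inj₂ b′} p q e = cong inj₂ (trans (sym p) q)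
neighbourIndex-injective (suc m) {inj₂ a} {inj₁ b} {inj₁ b′} p q e = cong inj₁ (trans (sym p) q)

degree≤neighbourIndex⊎parent : ∀ m {v w} (p : TAdj m v w) →
  degree m w ≤ suc (toℕ (neighbourIndex m p)) ⊎ suc (toℕ (neighbourIndex m p)) ≡ degree m v
degree≤neighbourIndex⊎parent (suc m) {inj₁ a} {inj₁ b} p with degree≤neighbourIndex⊎parent m p
... | inj₁ young  = inj₁ (s≤s young)
... | inj₂ parent = inj₂ (cong suc parent)
degree≤neighbourIndex⊎parent (suc m) {inj₁ a} {inj₂ b} p = inj₁ (s≤s z≤n)
degree≤neighbourIndex⊎parent (suc m) {inj₂ a} {inj₁ b} p = inj₂ refl

neighbourIndices-injective : ∀ m {n v} {w : Fin n → TV m} (adj : ∀ i → TAdj m v (w i)) →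
                             Injective _≡_ _≡_ w → Injective _≡_ _≡_ (λ i → neighbourIndex m (adj i))
neighbourIndices-injective m adj w-injective e =
  w-injective (neighbourIndex-injective m (adj _) (adj _) e)

injective-above⇒≤∸ : ∀ {n d a} (f : Fin n → Fin d) → Injective _≡_ _≡_ f →
                     (∀ j → a ≤ toℕ (f j)) → n ≤ d ∸ a
injective-above⇒≤∸ {n} {d} {a} f f-injective a≤f = injective⇒≤ {f = shift} shift-injective
  where
  shift< : ∀ j → toℕ (f j) ∸ a < d ∸ a
  shift< j = ∸-monoˡ-< (toℕ<n (f j)) (a≤f j)
  shift : Fin n → Fin (d ∸ a)
  shift j = fromℕ< (shift< j)
  shift-injective : Injective _≡_ _≡_ shift
  shift-injective {x} {y} e = f-injective (toℕ-injective (∸-cancelʳ-≡ (a≤f x) (a≤f y)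
    (trans (sym (toℕ-fromℕ< (shift< x))) (trans (cong toℕ e) (toℕ-fromℕ< (shift< y))))))

injective-high⇒n+n≤1+d : ∀ {n d} (f : Fin n → Fin d) → Injective _≡_ _≡_ f →
                        (∀ j → n ≤ suc (toℕ (f j))) → n + n ≤ suc d
injective-high⇒n+n≤1+d {zero}  f _           _   = z≤n
injective-high⇒n+n≤1+d {suc q} {d} f f-injective high = begin
  suc q + suc q   ≡⟨ +-suc (suc q) q ⟩
  suc (suc q + q) ≤⟨ s≤s (m≤o∸n⇒m+n≤o (suc q) q≤d room) ⟩
  suc d           ∎
  where
  open ≤-Reasoning
  room : suc q ≤ d ∸ q
  room = injective-above⇒≤∸ f f-injective (s≤s⁻¹ ∘ high)
  q≤d : q ≤ d
  q≤d = ≤-trans (n≤1+n q) (≤-trans room (m∸n≤m d q))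

n+n≤m⇒n≤⌊m/2⌋ : ∀ {n m} → n + n ≤ m → n ≤ ⌊ m /2⌋
n+n≤m⇒n≤⌊m/2⌋ {n} h = ≤-trans (≤-reflexive (n≡⌊n+n/2⌋ n)) (⌊n/2⌋-mono h)

module _ {m n} (Z : ZColoring (T (suc m)) (suc n)) where
  open ZColoring Z

  representative-degree : ∀ j → n ≤ degree m (u j)
  representative-degree j = injective⇒≤ (neighbourIndices-injective m adj neighbour-injective)
    where
    other : ∀ i → ∃[ w ] (TAdj m (u j) w × c w ≡ punchIn j i)
    other i = cond-iii (punchIn j i) j (punchInᵢ≢i j i)
    adj : ∀ i → TAdj m (u j) (proj₁ (other i))
    adj i = proj₁ (proj₂ (other i))
    neighbour-injective : Injective _≡_ _≡_ (proj₁ ∘ other)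
    neighbour-injective {x} {y} e = punchIn-injective j x y
      (trans (sym (proj₂ (proj₂ (other x)))) (trans (cong c e) (proj₂ (proj₂ (other y)))))

  n+n≤1+m : n + n ≤ suc m
  n+n≤1+m = ≤-trans (injective-high⇒n+n≤1+d index index-injective high)
                    (s≤s (degree≤ m (u last)))
    where
    last : Fin (suc n)
    last = fromℕ n
    adj : ∀ j → TAdj m (u last) (u (inject₁ j))
    adj j = cond-ii last (cong suc (toℕ-fromℕ n)) (inject₁ j) (fromℕ≢inject₁ ∘ sym)
    index : Fin n → Fin (degree m (u last))
    index j = neighbourIndex m (adj j)
    index-injective : Injective _≡_ _≡_ index
    index-injective = neighbourIndices-injective m adj λ {x} {y} e →
      inject₁-injective (trans (sym (u-col (inject₁ x))) (trans (cong c e) (u-col (inject₁ y))))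
    high : ∀ j → n ≤ suc (toℕ (index j))
    high j with degree≤neighbourIndex⊎parent m (adj j)
    ... | inj₁ young  = ≤-trans (representative-degree (inject₁ j)) young
    ... | inj₂ parent = subst (n ≤_) (sym parent) (representative-degree last)

zColours≤ : ∀ m n → ZColoring (T (suc m)) n → n ≤ ⌈ suc (suc m) /2⌉
zColours≤ m zero    _ = z≤n
zColours≤ m (suc n) Z = s≤s (n+n≤m⇒n≤⌊m/2⌋ (n+n≤1+m Z))

-- step r s is the label of a child having r children of a vertex labelled s.
module Labelling {S : Set} (s₀ : S) (step : ℕ → S → S) where

  -- o is the number of layers still to be added on top of T_(m+1).
  labelFrom : (m : ℕ) → TV m → ℕ → S
  labelFrom zero    _        o = s₀
  labelFrom (suc m) (inj₁ a) o = labelFrom m a (suc o)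
  labelFrom (suc m) (inj₂ a) o = step o (labelFrom m a (suc o))

  label : (m : ℕ) → TV m → S
  label m v = labelFrom m v 0

  label-invariant : (P : S → Set) → P s₀ → (∀ r s → P s → P (step r s)) → ∀ m v → P (label m v)
  label-invariant P P-s₀ P-step m v = go m v 0
    where
    go : ∀ m v o → P (labelFrom m v o)
    go zero    _        o = P-s₀
    go (suc m) (inj₁ a) o = go m a (suc o)
    go (suc m) (inj₂ a) o = P-step o _ (go m a (suc o))

  label-root : ∀ m → label m (root m) ≡ s₀
  label-root m = go m 0
    where
    go : ∀ m o → labelFrom m (root m) o ≡ s₀
    go zero    o = refl
    go (suc m) o = go m (suc o)

  label-child : ∀ m {v} r → r < childCount m v →
                ∃[ w ] (TAdj m v w × childCount m w ≡ r × label m w ≡ step r (label m v))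
  label-child m {v} r r<count with go m v 0 r z≤n r<count
    where
    go : ∀ m v o r → o ≤ r → r < o + childCount m v →
         ∃[ w ] (TAdj m v w × childCount m w + o ≡ r × labelFrom m w o ≡ step r (labelFrom m v o))
    go (suc m) (inj₁ a) o r o≤r r<o+count with o ≟ r
    ... | yes refl = inj₂ a , refl , refl , refl
    ... | no o≢r with go m a (suc o) r (≤∧≢⇒< o≤r o≢r) (subst (r <_) (+-suc o _) r<o+count)
    ...   | w , adj , count , e = inj₁ w , adj , trans (sym (+-suc _ o)) count , e
    go zero    _        o r o≤r r<o+0 = ⊥-elim (<⇒≱ r<o+0 (subst (_≤ r) (sym (+-identityʳ o)) o≤r))
    go (suc m) (inj₂ a) o r o≤r r<o+0 = ⊥-elim (<⇒≱ r<o+0 (subst (_≤ r) (sym (+-identityʳ o)) o≤r))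
  ... | w , adj , count , e = w , adj , trans (sym (+-identityʳ _)) count , e

  label-parent : ∀ m v → v ≡ root m ⊎
                 ∃[ p ] (TAdj m v p × label m v ≡ step (childCount m v) (label m p))
  label-parent m v = go m v 0
    where
    go : ∀ m v o → v ≡ root m ⊎
         ∃[ p ] (TAdj m v p × labelFrom m v o ≡ step (o + childCount m v) (labelFrom m p o))
    go zero    _        o = inj₁ refl
    go (suc m) (inj₁ a) o with go m a (suc o)
    ... | inj₁ a≡root        = inj₁ (cong inj₁ a≡root)
    ... | inj₂ (p , adj , e) =
      inj₂ (inj₁ p , adj , trans e (cong (λ r → step r (labelFrom m p (suc o))) (sym (+-suc o _))))
    go (suc m) (inj₂ a) o =
      inj₂ (inj₁ a , refl , cong (λ r → step r (labelFrom m a (suc o))) (sym (+-identityʳ o)))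

  label-proper : ∀ {A : Set} (colour : S → A) → (∀ r s → colour (step r s) ≢ colour s) →
                 ∀ m {v w} → TAdj m v w → colour (label m v) ≢ colour (label m w)
  label-proper colour step≢ m adj = go m adj 0
    where
    go : ∀ m {v w} → TAdj m v w → ∀ o → colour (labelFrom m v o) ≢ colour (labelFrom m w o)
    go (suc m) {inj₁ a} {inj₁ b} adj  o = go m adj (suc o)
    go (suc m) {inj₁ a} {inj₂ a} refl o = step≢ o _ ∘ sym
    go (suc m) {inj₂ a} {inj₁ a} refl o = step≢ o _

fallback : ℕ → ℕ
fallback zero    = 1
fallback (suc _) = 0

fallback≢ : ∀ x → fallback x ≢ x
fallback≢ zero    ()
fallback≢ (suc x) ()

fallback≤1 : ∀ x → fallback x ≤ 1
fallback≤1 zero    = s≤s z≤n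
fallback≤1 (suc x) = z≤n

childColour : (B x r : ℕ) → ℕ
childColour B x r with r <? B | r ≟ x
... | yes _ | no _ = r
... | _     | _    = fallback x

childColour≢ : ∀ B x r → childColour B x r ≢ x
childColour≢ B x r with r <? B | r ≟ x
... | yes _ | no r≢x   = r≢x
... | yes _ | yes _    = fallback≢ x
... | no _  | _        = fallback≢ x

childColour-own : ∀ {B x r} → r < B → r ≢ x → childColour B x r ≡ r
childColour-own {B} {x} {r} r<B r≢x with r <? B | r ≟ x
... | yes _   | no _    = refl
... | yes _   | yes r≡x = contradiction r≡x r≢x
... | no r≮B  | _       = contradiction r<B r≮B

childColour-cases : ∀ B x r → (r < B × childColour B x r ≡ r) ⊎ childColour B x r ≡ fallback x
childColour-cases B x r with r <? B | r ≟ x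
... | yes r<B | no _ = inj₁ (r<B , refl)
... | yes _   | yes _ = inj₂ refl
... | no _    | _     = inj₂ refl

k≤k+k∸j : ∀ {j k} → j ≤ k → k ≤ k + k ∸ j
k≤k+k∸j {j} {k} j≤k = ≤-trans (≤-reflexive (sym (m+n∸n≡m k k))) (∸-monoʳ-≤ (k + k) j≤k)

i<k+k∸j : ∀ {i j k} → i ≤ k → j ≤ k → i ≢ j → i < k + k ∸ j
i<k+k∸j {i} {j} {k} i≤k j≤k i≢j with i ≟ k
... | no i≢k   = <-≤-trans (≤∧≢⇒< i≤k i≢k) (k≤k+k∸j j≤k)
... | yes refl = subst (_< k + k ∸ j) (m+n∸n≡m k k) (∸-monoʳ-< (≤∧≢⇒< j≤k (i≢j ∘ sym)) (m≤m+n k k))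

data State : Set where
  apex : State
  node : (colour limit : ℕ) → State

module Construction (k : ℕ) where

  colour : State → ℕ
  colour apex       = suc k
  colour (node x _) = x

  limit : State → ℕ
  limit apex       = suc k
  limit (node _ B) = B

  apexChildColour : ℕ → ℕ
  apexChildColour r = (k + k ∸ r) ⊓ r

  apexChildColour≤k : ∀ r → apexChildColour r ≤ k
  apexChildColour≤k r with ≤-total r k
  ... | inj₁ r≤k = ≤-trans (m⊓n≤n (k + k ∸ r) r) r≤k
  ... | inj₂ k≤r = ≤-trans (m⊓n≤m (k + k ∸ r) r)
                     (≤-trans (∸-monoʳ-≤ (k + k) k≤r) (≤-reflexive (m+n∸n≡m k k)))

  apexChildColour-representative : ∀ {x} → x ≤ k → apexChildColour (k + k ∸ x) ≡ x
  apexChildColour-representative {x} x≤k = begin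
    (k + k ∸ (k + k ∸ x)) ⊓ (k + k ∸ x) ≡⟨ cong (_⊓ (k + k ∸ x)) (m∸[m∸n]≡n (≤-trans x≤k (m≤m+n k k))) ⟩
    x ⊓ (k + k ∸ x)                     ≡⟨ m≤n⇒m⊓n≡m (≤-trans x≤k (k≤k+k∸j x≤k)) ⟩
    x                                   ∎
    where open ≡-Reasoning

  step : ℕ → State → State
  step r apex       = node (apexChildColour r) (suc k)
  step r (node x B) = node (childColour B x r) (childColour B x r)

  step-colour≢ : ∀ r s → colour (step r s) ≢ colour s
  step-colour≢ r apex e      = <-irrefl e (s≤s (apexChildColour≤k r))
  step-colour≢ r (node x B)  = childColour≢ B x r

  Bounded : State → Set
  Bounded s = colour s ≤ suc k × limit s ≤ suc k

  step-bounded : ∀ r s → Bounded s → Bounded (step r s)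
  step-bounded r apex _ = m≤n⇒m≤1+n (apexChildColour≤k r) , ≤-refl
  step-bounded r (node x B) (_ , B≤) = y≤ , y≤
    where
    y≤ : childColour B x r ≤ suc k
    y≤ with childColour-cases B x r
    ... | inj₁ (r<B , e) = subst (_≤ suc k) (sym e) (≤-trans (<⇒≤ r<B) B≤)
    ... | inj₂ e         = subst (_≤ suc k) (sym e) (≤-trans (fallback≤1 x) (s≤s z≤n))

  open Labelling apex step

  colour-bounded : ∀ m v → colour (label m v) ≤ suc k
  colour-bounded m v = proj₁ (label-invariant Bounded (≤-refl , ≤-refl) step-bounded m v)

  child-coloured : ∀ m {v x B y} → label m v ≡ node x B → y < B → y ≢ x → y < childCount m v →
                   ∃[ w ] (TAdj m v w × colour (label m w) ≡ y)
  child-coloured m {v} {x} {B} {y} e y<B y≢x y<count with label-child m y y<count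
  ... | w , adj , _ , e′ =
    w , adj , trans (cong colour (trans e′ (cong (step y) e))) (childColour-own y<B y≢x)

  children-below : ∀ m {v x B y} → label m v ≡ node x B → x ≤ B → x ≤ childCount m v → y < x →
                   ∃[ w ] (TAdj m v w × colour (label m w) ≡ y)
  children-below m e x≤B x≤count y<x =
    child-coloured m e (<-≤-trans y<x x≤B) (<⇒≢ y<x) (<-≤-trans y<x x≤count)

  -- Splitting on this rather than on toℕ j ≟ suc k keeps u j from reducing in goals.
  top⊎low : ∀ (j : Fin (suc (suc k))) → toℕ j ≡ suc k ⊎ toℕ j ≢ suc k
  top⊎low j with toℕ j ≟ suc k
  ... | yes j≡ = inj₁ j≡
  ... | no j≢  = inj₂ j≢

  low≤k : ∀ (j : Fin (suc (suc k))) → toℕ j ≢ suc k → toℕ j ≤ k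
  low≤k j j≢ = s≤s⁻¹ (≤∧≢⇒< (s≤s⁻¹ (toℕ<n j)) j≢)

  module _ (m : ℕ) (2k<m : k + k < m) where

    IsRepresentative : ℕ → TV m → Set
    IsRepresentative x w =
      TAdj m (root m) w × childCount m w ≡ k + k ∸ x × label m w ≡ node x (suc k)

    representative : ∀ x → x ≤ k → ∃[ w ] IsRepresentative x w
    representative x x≤k with label-child m (k + k ∸ x) index<
      where
      index< : k + k ∸ x < childCount m (root m)
      index< = subst (k + k ∸ x <_) (sym (childCount-root m)) (≤-<-trans (m∸n≤m (k + k) x) 2k<m)
    ... | w , adj , count , e =
      w , adj , count , trans e (trans (cong (step (k + k ∸ x)) (label-root m))
                                       (cong (λ y → node y (suc k)) (apexChildColour-representative x≤k)))

    u : Fin (suc (suc k)) → TV m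
    u j with toℕ j ≟ suc k
    ... | yes _ = root m
    ... | no j≢ = proj₁ (representative (toℕ j) (low≤k j j≢))

    u-top : ∀ j → toℕ j ≡ suc k → u j ≡ root m
    u-top j j≡ with toℕ j ≟ suc k
    ... | yes _ = refl
    ... | no j≢ = contradiction j≡ j≢

    u-low : ∀ j → toℕ j ≢ suc k → IsRepresentative (toℕ j) (u j)
    u-low j j≢ with toℕ j ≟ suc k
    ... | yes j≡ = contradiction j≡ j≢
    ... | no j≢′ = proj₂ (representative (toℕ j) (low≤k j j≢′))

    lower-colours-via-parent :
      ∀ {v p y} s → TAdj m v p → label m p ≡ s → label m v ≡ step (childCount m v) s →
      y < colour (step (childCount m v) s) → ∃[ w ] (TAdj m v w × colour (label m w) ≡ y)
    lower-colours-via-parent {v} apex adj _ e y< =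
      children-below m e (m≤n⇒m≤1+n (apexChildColour≤k (childCount m v))) (m⊓n≤n _ _) y<
    lower-colours-via-parent {v} (node x B) adj ep e y< with childColour-cases B x (childCount m v)
    ... | inj₁ (_ , own) = children-below m e ≤-refl (≤-reflexive own) y<
    lower-colours-via-parent {p = p} {y} (node zero B) adj ep e y< | inj₂ fb =
      p , adj , trans (cong colour ep) (sym (n<1⇒n≡0 (subst (y <_) fb y<)))
    lower-colours-via-parent {y = y} (node (suc x) B) adj ep e y< | inj₂ fb =
      ⊥-elim (n≮0 (subst (y <_) fb y<))

    lower-colours : ∀ v {y} → y < colour (label m v) → ∃[ w ] (TAdj m v w × colour (label m w) ≡ y)
    lower-colours v {y} y< with label-parent m v
    ... | inj₁ refl with representative y (s≤s⁻¹ (subst (λ s → y < colour s) (label-root m) y<))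
    ...   | w , adj , _ , e = w , adj , cong colour e
    lower-colours v {y} y< | inj₂ (p , adj , e) =
      lower-colours-via-parent (label m p) adj refl e (subst (λ s → y < colour s) e y<)

    colourFin : TV m → Fin (suc (suc k))
    colourFin v = fromℕ< (s≤s (colour-bounded m v))

    toℕ-colourFin : ∀ v → toℕ (colourFin v) ≡ colour (label m v)
    toℕ-colourFin v = toℕ-fromℕ< (s≤s (colour-bounded m v))

    colourFin-≡ : ∀ {w} i → colour (label m w) ≡ toℕ i → colourFin w ≡ i
    colourFin-≡ {w} i e = toℕ-injective (trans (toℕ-colourFin w) e)

    neighbour-colourFin : ∀ {v i} → ∃[ w ] (TAdj m v w × colour (label m w) ≡ toℕ i) →
                          ∃[ w ] (TAdj m v w × colourFin w ≡ i)
    neighbour-colourFin {i = i} (w , adj , e) = w , adj , colourFin-≡ i e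

    u-col : ∀ j → colourFin (u j) ≡ j
    u-col j with top⊎low j
    ... | inj₁ j≡ = colourFin-≡ j (trans (cong (colour ∘ label m) (u-top j j≡))
                                         (trans (cong colour (label-root m)) (sym j≡)))
    ... | inj₂ j≢ = colourFin-≡ j (cong colour (proj₂ (proj₂ (u-low j j≢))))

    zColoring : ZColoring (T (suc m)) (suc (suc k))
    zColoring = record
      { c        = colourFin
      ; proper   = λ v w adj e → label-proper colour step-colour≢ m adj
                     (trans (sym (toℕ-colourFin v)) (trans (cong toℕ e) (toℕ-colourFin w)))
      ; cond-i   = λ v i i< →
                     neighbour-colourFin (lower-colours v (subst (toℕ i <_) (toℕ-colourFin v) i<))
      ; u        = u
      ; u-col    = u-col
      ; cond-ii  = cond-ii
      ; cond-iii = cond-iii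
      }
      where
      cond-ii : ∀ l → suc (toℕ l) ≡ suc (suc k) → ∀ j → j ≢ l → TAdj m (u l) (u j)
      cond-ii l l-last j j≢l = subst (λ v → TAdj m v (u j)) (sym (u-top l l≡)) (proj₁ (u-low j j≢))
        where
        l≡ : toℕ l ≡ suc k
        l≡ = suc-injective l-last
        j≢ : toℕ j ≢ suc k
        j≢ e = j≢l (toℕ-injective (trans e (sym l≡)))
      cond-iii : ∀ i j → i ≢ j → ∃[ w ] (TAdj m (u j) w × colourFin w ≡ i)
      cond-iii i j i≢j with top⊎low i | top⊎low j
      ... | inj₁ i≡ | inj₁ j≡ = contradiction (toℕ-injective (trans i≡ (sym j≡))) i≢j
      ... | inj₂ i≢ | inj₁ j≡ =
        u i , subst (λ v → TAdj m v (u i)) (sym (u-top j j≡)) (proj₁ (u-low i i≢)) , u-col i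
      ... | inj₁ i≡ | inj₂ j≢ =
        root m , TAdj-sym m (proj₁ (u-low j j≢)) , colourFin-≡ i (trans (cong colour (label-root m)) (sym i≡))
      ... | inj₂ i≢ | inj₂ j≢ with u-low j j≢
      ...   | _ , count , e = neighbour-colourFin (child-coloured m e (s≤s i≤k) i≢j′ i<count)
        where
        i≤k : toℕ i ≤ k
        i≤k = low≤k i i≢
        i≢j′ : toℕ i ≢ toℕ j
        i≢j′ = i≢j ∘ toℕ-injective
        i<count : toℕ i < childCount m (u j)
        i<count = subst (toℕ i <_) (sym count) (i<k+k∸j i≤k (low≤k j j≢) i≢j′)

zColoring-T₁ : ZColoring (T 1) 1
zColoring-T₁ = record
  { c        = λ _ → fzero
  ; proper   = λ v w ()
  ; cond-i   = λ v i ()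
  ; u        = λ _ → _
  ; u-col    = λ { fzero → refl }
  ; cond-ii  = λ { fzero _ fzero 0≢0 → contradiction refl 0≢0 }
  ; cond-iii = λ { fzero fzero 0≢0 → contradiction refl 0≢0 }
  }

⌊n/2⌋+⌊n/2⌋≤n : ∀ n → ⌊ n /2⌋ + ⌊ n /2⌋ ≤ n
⌊n/2⌋+⌊n/2⌋≤n n = ≤-trans (+-monoʳ-≤ ⌊ n /2⌋ (⌊n/2⌋≤⌈n/2⌉ n)) (≤-reflexive (⌊n/2⌋+⌈n/2⌉≡n n))

proposition5 : ∀ (k : ℕ) → 1 ≤ k → zNumberIs (T k) ⌈ suc k /2⌉
proposition5 (suc zero)    _ = zColoring-T₁ , zColours≤ 0
proposition5 (suc (suc m)) _ =
  Construction.zColoring ⌊ m /2⌋ (suc m) (s≤s (⌊n/2⌋+⌊n/2⌋≤n m)) , zColours≤ (suc m)
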